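{- Let $G\in\mathcal{F}_{\rm cub}$ have order $n$, and let $\lambda$ be an eigenvalue of the adjacency matrix of $G$ that has an eigenvector of the second type (with respect to the partition $\Pi$). If $n\equiv 2\pmod 4$, then $\lambda\in\{0,-1\}$. If $n\equiv 0\pmod 4$, then $\lambda\in\{0,-1,(-1+\sqrt5)/2,(-1-\sqrt5)/2\}$.
   Context: Graphs are simple and eigenvalues are those of the adjacency matrix. A diamond is $K_4$ minus one edge; its two vertices of degree $2$ are its tips, and the other two vertices are its middle vertices. Let $L$ be the graph on $u_1,\dots,u_5$ with edges $u_1u_2$, $u_iu_j$ for $i\in\{1,2\}$ and $j\in\{3,4\}$, and $u_3u_5,u_4u_5$; its attachment vertex is $u_5$. Let $L'$ be the graph on $w_1,\dots,w_7$ with edges $w_1w_2$, $w_iw_j$ for $i\in\{1,2\}$ and $j\in\{3,4\}$, and $w_3w_5,w_4w_6,w_5w_6,w_5w_7,w_6w_7$; its attachment vertex is $w_7$. For $q\ge0$ and $E\in\{L,L'\}$, build a cubic graph from a copy of $L$, diamonds $B_1,\dots,B_q$, and a copy of $E$ by adding bridges as follows. Join the attachment vertex of $L$ to one tip of $B_1$. For each $i<q$, join the other tip of $B_i$ to a tip of $B_{i+1}$. Join the other tip of $B_q$ to the attachment vertex of $E$; if $q=0$, join the two attachment vertices directly. The order is $10+4q$ if $E=L$ and $12+4q$ if $E=L'$. $\mathcal{F}_{\rm cub}$ is the family of all these graphs, which contains exactly one graph of each even order $n\ge10$. The partition $\Pi$ of $V(G)$ has the following cells: $\{u_1,u_2\},\{u_3,u_4\},\{u_5\}$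 in each copy of $L$; $\{w_1,w_2\},\{w_3,w_4\},\{w_5,w_6\},\{w_7\}$ in $L'$; and, for each diamond, each tip as a singleton cell and the two middle vertices as one cell. This partition is equitable. An eigenvector is of the second type if its entries sum to zero on every cell of $\Pi$. -}

module Defs where

open import Level using (Level; _⊔_) renaming (suc to lsuc)
open import Algebra.Bundles using (CommutativeRing)
open import Data.Nat using (ℕ)
open import Data.Fin using (Fin; #_) renaming (zero to f0; suc to fs)
open import Data.Fin.Properties using () renaming (_≟_ to _≟F_)
open import Data.Bool using (Bool; true; false; _∧_; _∨_; if_then_else_)
open import Data.Bool.ListAction using (any)
open import Data.List using (List; []; _∷_; _++_; map; concatMap; allFin; zip; foldr; length)
open import Data.List.Relation.Unary.All using (All)
open import Data.Product using (Σ; _×_; _,_; ∃)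
open import Relation.Nullary using (¬_)
open import Relation.Nullary.Decidable using (⌊_⌋)

record Field (c ℓ : Level) : Set (lsuc (c ⊔ ℓ)) where
  field
    commutativeRing : CommutativeRing c ℓ
  open CommutativeRing commutativeRing public
  field
    1≉0     : ¬ (1# ≈ 0#)
    inverse : ∀ x → ¬ (x ≈ 0#) → ∃ λ y → (x * y) ≈ 1#

-- The family F_cub.  A graph is determined by q ∈ ℕ (number of diamonds)
-- and the choice of end gadget E ∈ {L, L'}.

data End : Set where
  endL endL' : End

-- Fin-indices are 0-based:
--   uL k       = u_{k+1} of the first copy of L      (k < 5)
--   dm i k     = vertex k of diamond B_{i+1}; k = 0 and k = 3 are the tips,
--                k = 1, 2 the middle vertices
--   eL k       = u_{k+1} of the end copy of L        (only when E = L)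
--   eL' k      = w_{k+1} of L'                       (only when E = L')
data Vtx (q : ℕ) : End → Set where
  uL  : ∀ {E} → Fin 5 → Vtx q E
  dm  : ∀ {E} → Fin q → Fin 4 → Vtx q E
  eL  : Fin 5 → Vtx q endL
  eL' : Fin 7 → Vtx q endL'

private
  _==F_ : ∀ {m} → Fin m → Fin m → Bool
  a ==F b = ⌊ a ≟F b ⌋

_==V_ : ∀ {q E} → Vtx q E → Vtx q E → Bool
uL a   ==V uL b   = a ==F b
dm i a ==V dm j b = (i ==F j) ∧ (a ==F b)
eL a   ==V eL b   = a ==F b
eL' a  ==V eL' b  = a ==F b
_      ==V _      = false

edgesL : List (Fin 5 × Fin 5)
edgesL = (# 0 , # 1) ∷ (# 0 , # 2) ∷ (# 0 , # 3) ∷ (# 1 , # 2) ∷ (# 1 , # 3) ∷ (# 2 , # 4) ∷ (# 3 , # 4) ∷ []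

edgesL' : List (Fin 7 × Fin 7)
edgesL' = (# 0 , # 1) ∷ (# 0 , # 2) ∷ (# 0 , # 3) ∷ (# 1 , # 2) ∷ (# 1 , # 3)
        ∷ (# 2 , # 4) ∷ (# 3 , # 5) ∷ (# 4 , # 5) ∷ (# 4 , # 6) ∷ (# 5 , # 6) ∷ []

-- Edges of a diamond (K4 minus the edge between the tips 0 and 3).
edgesD : List (Fin 4 × Fin 4)
edgesD = (# 0 , # 1) ∷ (# 0 , # 2) ∷ (# 1 , # 2) ∷ (# 1 , # 3) ∷ (# 2 , # 3) ∷ []

mapEdge : ∀ {A B : Set} → (A → B) → List (A × A) → List (B × B)
mapEdge f = map (λ { (a , b) → (f a , f b) })

attach : ∀ {q} (E : End) → Vtx q E
attach endL  = eL (# 4)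
attach endL' = eL' (# 6)

-- Bridges: u_5 — B_1 — B_2 — … — B_q — attachment vertex of E,
-- each diamond entered at tip 0 and left at tip 3
-- (for q = 0: u_5 joined directly to the attachment vertex of E).
bridges : ∀ q E → List (Vtx q E × Vtx q E)
bridges q E = zip (uL (# 4) ∷ map (λ i → dm i (# 3)) (allFin q))
                  (map (λ i → dm i (# 0)) (allFin q) ++ (attach E ∷ []))

endEdges : ∀ q E → List (Vtx q E × Vtx q E)
endEdges q endL  = mapEdge eL edgesL
endEdges q endL' = mapEdge eL' edgesL'

edges : ∀ q E → List (Vtx q E × Vtx q E)
edges q E = mapEdge uL edgesL
         ++ concatMap (λ i → mapEdge (dm i) edgesD) (allFin q)
         ++ endEdges q E
         ++ bridges q E

adj : ∀ {q E} → Vtx q E → Vtx q E → Bool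
adj {q} {E} v w = any (λ { (a , b) → ((a ==V v) ∧ (b ==V w)) ∨ ((a ==V w) ∧ (b ==V v)) }) (edges q E)

endVertices : ∀ q E → List (Vtx q E)
endVertices q endL  = map eL (allFin 5)
endVertices q endL' = map eL' (allFin 7)

vertices : ∀ q E → List (Vtx q E)
vertices q E = map uL (allFin 5)
            ++ concatMap (λ i → map (dm i) (allFin 4)) (allFin q)
            ++ endVertices q E

-- Order of the graph: 10 + 4q for E = L, 12 + 4q for E = L'.
order : ℕ → End → ℕ
order q E = length (vertices q E)

endCells : ∀ q E → List (List (Vtx q E))
endCells q endL  = (eL (# 0) ∷ eL (# 1) ∷ []) ∷ (eL (# 2) ∷ eL (# 3) ∷ []) ∷ (eL (# 4) ∷ []) ∷ []
endCells q endL' = (eL' (# 0) ∷ eL' (# 1) ∷ []) ∷ (eL' (# 2) ∷ eL' (# 3) ∷ []) ∷ (eL' (# 4) ∷ eL' (# 5) ∷ [])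
                 ∷ (eL' (# 6) ∷ []) ∷ []

cells : ∀ q E → List (List (Vtx q E))
cells q E = ((uL (# 0) ∷ uL (# 1) ∷ []) ∷ (uL (# 2) ∷ uL (# 3) ∷ []) ∷ (uL (# 4) ∷ []) ∷ [])
         ++ concatMap (λ i → (dm i (# 0) ∷ []) ∷ (dm i (# 1) ∷ dm i (# 2) ∷ []) ∷ (dm i (# 3) ∷ []) ∷ [])
                      (allFin q)
         ++ endCells q E

module _ {c ℓ} (F : Field c ℓ) where
  open Field F

  sumL : List Carrier → Carrier
  sumL = foldr _+_ 0#

  adjMul : ∀ {q E} → (Vtx q E → Carrier) → Vtx q E → Carrier
  adjMul {q} {E} x v = sumL (map (λ w → if adj v w then x w else 0#) (vertices q E))

  IsEigenvector : ∀ q E → Carrier → (Vtx q E → Carrier) → Set ℓ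
  IsEigenvector q E λ' x =
    (∃ λ v → ¬ (x v ≈ 0#)) × (∀ v → adjMul x v ≈ (λ' * x v))

  SecondType : ∀ q E → (Vtx q E → Carrier) → Set ℓ
  SecondType q E x = All (λ C → sumL (map x C) ≈ 0#) (cells q E)

  -- λ = (-1 + s)/2 or (-1 - s)/2 where s² = 5, written without division:
  -- 2λ = -1 + s for some square root s of 5 (s ranges over both roots).
  IsGoldenValue : Carrier → Set (c ⊔ ℓ)
  IsGoldenValue λ' = ∃ λ s → ((s * s) ≈ (1# + 1# + 1# + 1# + 1#)) × ((λ' + λ') ≈ ((- 1#) + s))

-- An eigenvector x of the second type vanishes on every singleton cell of Π and takes opposite
-- values on the two vertices of every other cell.  The singleton cells are exactly the endpoints
-- of the bridges, so x is supported on vertices whose neighbourhood lies inside their own gadget,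
-- and at such a vertex the eigen-equation only involves that gadget.  If x(u₁) ≠ 0 in a copy of L
-- it reads λ x(u₁) = x(u₂) + x(u₃) + x(u₄) = -x(u₁), so λ = -1; if x(u₃) ≠ 0 it reads
-- λ x(u₃) = x(u₁) + x(u₂) + x(u₅) = 0, so λ = 0; in a diamond λ x = -x at a middle vertex.
-- In L' the same holds at w₁, while at w₃ and w₅ the equations λ x(w₃) = x(w₅) and
-- λ x(w₅) = x(w₃) - x(w₅) force λ² + λ = 1, that is λ = (-1 ± √5)/2.  This last case only arises
-- for E = L', whose order 12 + 4q is divisible by 4.

module Submission where

open import Defs
open import Data.Nat using (ℕ; _%_)
open import Data.Sum using (_⊎_)
open import Data.Product using (_×_)
open import Relation.Binary.PropositionalEquality using (_≡_)

open import Level using (_⊔_)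
open import Algebra.Bundles using (Monoid; CommutativeMonoid)
open import Data.Bool using (Bool; true; false; _∧_; _∨_; if_then_else_)
open import Data.Bool.Properties using (∧-zeroʳ; ∨-identityʳ; ∨-commutativeMonoid)
open import Data.Bool.ListAction using (any)
open import Data.Fin using (Fin; #_) renaming (zero to fzero; suc to fsuc)
open import Data.Fin.Properties using (suc-injective; _≟_)
open import Data.List using (List; []; _∷_; _++_; map; concat; concatMap; allFin; tabulate; foldr; zip; length; filterᵇ)
open import Data.List.Properties using (map-∘; map-tabulate; map-cong; length-++)
open import Data.List.Relation.Unary.All as All using (All; []; _∷_)
import Data.List.Relation.Unary.All.Properties as AllP
open import Data.Nat.DivMod using ([m+kn]%n≡m%n)
open import Data.Product using (_,_; proj₁; proj₂)
open import Data.Sum using (inj₁; inj₂)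
import Data.Sum as Sum
open import Function using (_∘_)
import Relation.Binary.PropositionalEquality as ≡
open import Relation.Binary.PropositionalEquality using (_≢_)
open import Relation.Nullary using (contradiction)
open import Relation.Nullary.Decidable using (⌊_⌋; isYes≗does; dec-true; dec-false)

module FoldMap {a ℓ} (M : Monoid a ℓ) where
  open Monoid M

  foldMap : ∀ {A : Set} → (A → Carrier) → List A → Carrier
  foldMap f xs = foldr _∙_ ε (map f xs)

  module _ {A : Set} (f : A → Carrier) where

    foldMap-++ : ∀ xs ys → foldMap f (xs ++ ys) ≈ foldMap f xs ∙ foldMap f ys
    foldMap-++ []       ys = sym (identityˡ _)
    foldMap-++ (x ∷ xs) ys = trans (∙-congˡ (foldMap-++ xs ys)) (sym (assoc _ _ _))

    foldMap-ε : ∀ {xs} → All (λ x → f x ≈ ε) xs → foldMap f xs ≈ ε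
    foldMap-ε []         = refl
    foldMap-ε (fx≈ε ∷ p) = trans (∙-cong fx≈ε (foldMap-ε p)) (identityˡ ε)

    foldMap-map : ∀ {B : Set} (g : B → A) xs → foldMap f (map g xs) ≡ foldMap (f ∘ g) xs
    foldMap-map g xs = ≡.cong (foldr _∙_ ε) (≡.sym (map-∘ xs))

    foldMap-if : ∀ (p : A → Bool) xs → foldMap (λ x → if p x then f x else ε) xs ≈ foldMap f (filterᵇ p xs)
    foldMap-if p []       = refl
    foldMap-if p (x ∷ xs) with p x
    ... | true  = ∙-congˡ (foldMap-if p xs)
    ... | false = trans (identityˡ _) (foldMap-if p xs)

    foldMap-concat-tabulate-ε : ∀ {n} (G : Fin n → List A) → (∀ j → foldMap f (G j) ≈ ε) →
                                foldMap f (concat (tabulate G)) ≈ ε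
    foldMap-concat-tabulate-ε {ℕ.zero}  G G≈ε = refl
    foldMap-concat-tabulate-ε {ℕ.suc n} G G≈ε = trans (foldMap-++ (G fzero) _)
      (trans (∙-cong (G≈ε fzero) (foldMap-concat-tabulate-ε (G ∘ fsuc) (G≈ε ∘ fsuc))) (identityˡ ε))

    foldMap-concat-tabulate-single : ∀ {n} (G : Fin n → List A) i → (∀ j → j ≢ i → foldMap f (G j) ≈ ε) →
                                     foldMap f (concat (tabulate G)) ≈ foldMap f (G i)
    foldMap-concat-tabulate-single G fzero G≈ε = trans (foldMap-++ (G fzero) _)
      (trans (∙-congˡ (foldMap-concat-tabulate-ε (G ∘ fsuc) (λ j → G≈ε (fsuc j) λ ())))
             (identityʳ _))
    foldMap-concat-tabulate-single G (fsuc i) G≈ε = trans (foldMap-++ (G fzero) _)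
      (trans (∙-congʳ (G≈ε fzero λ ()))
      (trans (identityˡ _)
             (foldMap-concat-tabulate-single (G ∘ fsuc) i (λ j j≢i → G≈ε (fsuc j) (j≢i ∘ suc-injective)))))

    foldMap-concatMap-allFin-single : ∀ {n} (g : Fin n → List A) i → (∀ j → j ≢ i → foldMap f (g j) ≈ ε) →
                                      foldMap f (concatMap g (allFin n)) ≈ foldMap f (g i)
    foldMap-concatMap-allFin-single g i g≈ε =
      trans (reflexive (≡.cong (foldMap f ∘ concat) (map-tabulate (λ j → j) g)))
            (foldMap-concat-tabulate-single g i g≈ε)

module AnyMonoid = FoldMap (CommutativeMonoid.monoid ∨-commutativeMonoid)

module _ {A : Set} (_==_ : A → A → Bool) where

  -- adj v w of Defs is definitionally any (linked _==V_ v w) (edges q E).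
  linked : A → A → A × A → Bool
  linked v w (a , b) = ((a == v) ∧ (b == w)) ∨ ((a == w) ∧ (b == v))

  NotOn : A → A × A → Set
  NotOn v (a , b) = ((a == v) ≡ false) × ((b == v) ≡ false)

  linked-NotOnˡ : ∀ {v} w e → NotOn v e → linked v w e ≡ false
  linked-NotOnˡ w (a , b) (a≠v , b≠v) rewrite a≠v | b≠v = ∧-zeroʳ (a == w)

  linked-NotOnʳ : ∀ v {w} e → NotOn w e → linked v w e ≡ false
  linked-NotOnʳ v (a , b) (a≠w , b≠w) rewrite a≠w | b≠w = ≡.trans (∨-identityʳ _) (∧-zeroʳ (a == v))

  open AnyMonoid using (foldMap-++; foldMap-ε)

  any-linked-NotOnˡ : ∀ v w {es} → All (NotOn v) es → any (linked v w) es ≡ false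
  any-linked-NotOnˡ v w p = foldMap-ε _ (All.map (λ {e} → linked-NotOnˡ w e) p)

  any-linked-NotOnʳ : ∀ v w {es} → All (NotOn w) es → any (linked v w) es ≡ false
  any-linked-NotOnʳ v w p = foldMap-ε _ (All.map (λ {e} → linked-NotOnʳ v e) p)

  any-linked-++ˡ : ∀ v w es fs → All (NotOn v) es → any (linked v w) (es ++ fs) ≡ any (linked v w) fs
  any-linked-++ˡ v w es fs p = ≡.trans (foldMap-++ _ es _) (≡.cong (_∨ _) (any-linked-NotOnˡ v w p))

  any-linked-++ʳ : ∀ v w es fs → All (NotOn v) fs → any (linked v w) (es ++ fs) ≡ any (linked v w) es
  any-linked-++ʳ v w es fs p =
    ≡.trans (foldMap-++ _ es _) (≡.trans (≡.cong (_ ∨_) (any-linked-NotOnˡ v w p)) (∨-identityʳ _))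

mapEdge-NotOn : ∀ {A B : Set} (_==_ : A → A → Bool) (f : B → A) {v} →
                (∀ b → (f b == v) ≡ false) → ∀ es → All (NotOn _==_ v) (mapEdge f es)
mapEdge-NotOn _==_ f f≠v []             = []
mapEdge-NotOn _==_ f f≠v ((a , b) ∷ es) = (f≠v a , f≠v b) ∷ mapEdge-NotOn _==_ f f≠v es

module _ {A B : Set} (_==A_ : A → A → Bool) (_==B_ : B → B → Bool) (f : B → A) where

  any-linked-mapEdge : (∀ a b → (f a ==A f b) ≡ (a ==B b)) →
                       ∀ a b es → any (linked _==A_ (f a) (f b)) (mapEdge f es) ≡ any (linked _==B_ a b) es
  any-linked-mapEdge f-pres a b []             = ≡.refl
  any-linked-mapEdge f-pres a b ((c , d) ∷ es)
    rewrite f-pres c a | f-pres d b | f-pres c b | f-pres d a =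
      ≡.cong (_ ∨_) (any-linked-mapEdge f-pres a b es)

All-zip : ∀ {A B : Set} {P : A → Set} {Q : B → Set} {xs ys} → All P xs → All Q ys →
          All (λ e → P (proj₁ e) × Q (proj₂ e)) (zip xs ys)
All-zip []       _        = []
All-zip (_ ∷ _)  []       = []
All-zip (p ∷ ps) (r ∷ rs) = (p , r) ∷ All-zip ps rs

All-concatMap-allFin⁻ : ∀ {p} {A : Set} {P : A → Set p} {n} (g : Fin n → List A) →
                        All P (concatMap g (allFin n)) → ∀ i → All P (g i)
All-concatMap-allFin⁻ g = AllP.tabulate⁻ ∘ AllP.map⁻ ∘ AllP.concat⁻

All-map-allFin : ∀ {p} {A : Set} {P : A → Set p} {n} (f : Fin n → A) → (∀ i → P (f i)) →
                 All P (map f (allFin n))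
All-map-allFin f Pf = AllP.map⁺ (AllP.tabulate⁺ Pf)

All-concatMap-allFin : ∀ {p} {A : Set} {P : A → Set p} {n} (g : Fin n → List A) → (∀ i → All P (g i)) →
                       All P (concatMap g (allFin n))
All-concatMap-allFin g Pg = AllP.concat⁺ (All-map-allFin g Pg)

-- Local structure of the graphs in F_cub

cellsL : List (List (Fin 5))
cellsL = (# 0 ∷ # 1 ∷ []) ∷ (# 2 ∷ # 3 ∷ []) ∷ (# 4 ∷ []) ∷ []

cellsD : List (List (Fin 4))
cellsD = (# 0 ∷ []) ∷ (# 1 ∷ # 2 ∷ []) ∷ (# 3 ∷ []) ∷ []

cellsL' : List (List (Fin 7))
cellsL' = (# 0 ∷ # 1 ∷ []) ∷ (# 2 ∷ # 3 ∷ []) ∷ (# 4 ∷ # 5 ∷ []) ∷ (# 6 ∷ []) ∷ []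

-- Definitionally the boolean equality that Defs uses on Fin, so uL a ==V uL b reduces to a ==F b.
_==F_ : ∀ {m} → Fin m → Fin m → Bool
a ==F b = ⌊ a ≟ b ⌋

endSize : End → ℕ
endSize endL  = 5
endSize endL' = 7

endV : ∀ {q} E → Fin (endSize E) → Vtx q E
endV endL  = eL
endV endL' = eL'

endEdgeList : ∀ E → List (Fin (endSize E) × Fin (endSize E))
endEdgeList endL  = edgesL
endEdgeList endL' = edgesL'

attachIndex : ∀ E → Fin (endSize E)
attachIndex endL  = # 4
attachIndex endL' = # 6

module _ {q : ℕ} where

  endEdges-mapEdge : ∀ E → endEdges q E ≡ mapEdge (endV E) (endEdgeList E)
  endEdges-mapEdge endL  = ≡.refl
  endEdges-mapEdge endL' = ≡.refl

  endVertices-map : ∀ E → endVertices q E ≡ map (endV E) (allFin (endSize E))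
  endVertices-map endL  = ≡.refl
  endVertices-map endL' = ≡.refl

  attach-endV : ∀ E → attach {q} E ≡ endV E (attachIndex E)
  attach-endV endL  = ≡.refl
  attach-endV endL' = ≡.refl

  endV-==V-endV : ∀ E b c → (endV {q} E b ==V endV E c) ≡ (b ==F c)
  endV-==V-endV endL  b c = ≡.refl
  endV-==V-endV endL' b c = ≡.refl

  endV-==V-uL : ∀ E k a → (endV {q} E k ==V uL a) ≡ false
  endV-==V-uL endL  k a = ≡.refl
  endV-==V-uL endL' k a = ≡.refl

  endV-==V-dm : ∀ E k j b → (endV {q} E k ==V dm j b) ≡ false
  endV-==V-dm endL  k j b = ≡.refl
  endV-==V-dm endL' k j b = ≡.refl

  uL-==V-endV : ∀ E a k → (uL a ==V endV {q} E k) ≡ false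
  uL-==V-endV endL  a k = ≡.refl
  uL-==V-endV endL' a k = ≡.refl

  dm-==V-endV : ∀ E j b k → (dm j b ==V endV {q} E k) ≡ false
  dm-==V-endV endL  j b k = ≡.refl
  dm-==V-endV endL' j b k = ≡.refl

  endEdges-NotOn : ∀ E {v : Vtx q E} → (∀ k → (endV E k ==V v) ≡ false) → All (NotOn _==V_ v) (endEdges q E)
  endEdges-NotOn E endV≠v =
    ≡.subst (All _) (≡.sym (endEdges-mapEdge E)) (mapEdge-NotOn _==V_ (endV E) endV≠v (endEdgeList E))

  All-endVertices : ∀ {p} E {P : Vtx q E → Set p} → (∀ k → P (endV E k)) → All P (endVertices q E)
  All-endVertices E Pk = ≡.subst (All _) (≡.sym (endVertices-map E)) (All-map-allFin (endV E) Pk)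

  bridges-NotOn : ∀ {E} {v : Vtx q E} → (uL (# 4) ==V v) ≡ false → (∀ j → (dm j (# 3) ==V v) ≡ false) →
                  (∀ j → (dm j (# 0) ==V v) ≡ false) → (endV E (attachIndex E) ==V v) ≡ false →
                  All (NotOn _==V_ v) (bridges q E)
  bridges-NotOn {E} u₅≠v t₃≠v t₀≠v att≠v =
    All-zip (u₅≠v ∷ All-map-allFin _ t₃≠v)
            (AllP.++⁺ (All-map-allFin _ t₀≠v)
                      (≡.subst (λ a → (a ==V _) ≡ false) (≡.sym (attach-endV E)) att≠v ∷ []))

module _ {q : ℕ} {E : End} where

  dm-==V-same : ∀ i a b → (dm {q} {E} i a ==V dm i b) ≡ (a ==F b)
  dm-==V-same i a b = ≡.cong (_∧ (a ==F b)) (≡.trans (isYes≗does (i ≟ i)) (dec-true (i ≟ i) ≡.refl))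

  dm-==V-other : ∀ {i j} a b → i ≢ j → (dm {q} {E} i a ==V dm j b) ≡ false
  dm-==V-other {i} {j} a b i≢j = ≡.cong (_∧ (a ==F b)) (≡.trans (isYes≗does (i ≟ j)) (dec-false (i ≟ j) i≢j))

  diamondEdges : List (Vtx q E × Vtx q E)
  diamondEdges = concatMap (λ j → mapEdge (dm j) edgesD) (allFin q)

  diamondVertices : List (Vtx q E)
  diamondVertices = concatMap (λ j → map (dm j) (allFin 4)) (allFin q)

  diamondCells : List (List (Vtx q E))
  diamondCells = concatMap (λ i → map (map (dm i)) cellsD) (allFin q)

  adj-uL : ∀ a → (uL (# 4) ==V uL {q} {E} a) ≡ false →
           ∀ w → adj (uL a) w ≡ any (linked _==V_ (uL a) w) (mapEdge uL edgesL)
  adj-uL a a≠u₅ w =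
    any-linked-++ʳ _==V_ (uL a) w (mapEdge uL edgesL) (diamondEdges ++ endEdges q E ++ bridges q E)
    (AllP.++⁺ (All-concatMap-allFin _ (λ j → mapEdge-NotOn _==V_ (dm j) (λ _ → ≡.refl) edgesD))
    (AllP.++⁺ (endEdges-NotOn E (λ k → endV-==V-uL E k a))
              (bridges-NotOn a≠u₅ (λ _ → ≡.refl) (λ _ → ≡.refl) (endV-==V-uL E _ a))))

  adj-dm : ∀ i w → adj (dm {q} {E} i (# 1)) w ≡ any (linked _==V_ (dm i (# 1)) w) (mapEdge (dm i) edgesD)
  adj-dm i w = begin
    any p (mapEdge uL edgesL ++ diamondEdges ++ endEdges q E ++ bridges q E)
      ≡⟨ any-linked-++ˡ _==V_ (dm i (# 1)) w (mapEdge uL edgesL) (diamondEdges ++ endEdges q E ++ bridges q E)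
           (mapEdge-NotOn _==V_ uL (λ _ → ≡.refl) edgesL) ⟩
    any p (diamondEdges ++ endEdges q E ++ bridges q E)
      ≡⟨ any-linked-++ʳ _==V_ (dm i (# 1)) w diamondEdges (endEdges q E ++ bridges q E)
           (AllP.++⁺ (endEdges-NotOn E (λ k → endV-==V-dm E k i (# 1)))
                     (bridges-NotOn ≡.refl (λ _ → ∧-zeroʳ _) (λ _ → ∧-zeroʳ _) (endV-==V-dm E _ i (# 1)))) ⟩
    any p diamondEdges
      ≡⟨ AnyMonoid.foldMap-concatMap-allFin-single p (λ j → mapEdge (dm j) edgesD) i
           (λ j j≢i → any-linked-NotOnˡ _==V_ (dm i (# 1)) w
                        (mapEdge-NotOn _==V_ (dm j) (λ b → dm-==V-other b (# 1) j≢i) edgesD)) ⟩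
    any p (mapEdge (dm i) edgesD) ∎
    where
    open ≡.≡-Reasoning
    p : Vtx q E × Vtx q E → Bool
    p = linked _==V_ (dm i (# 1)) w

  adj-end : ∀ a → (endV E (attachIndex E) ==V endV {q} E a) ≡ false →
            ∀ w → adj (endV E a) w ≡ any (linked _==V_ (endV E a) w) (mapEdge (endV E) (endEdgeList E))
  adj-end a att≠a w = begin
    any p (mapEdge uL edgesL ++ diamondEdges ++ endEdges q E ++ bridges q E)
      ≡⟨ any-linked-++ˡ _==V_ (endV E a) w (mapEdge uL edgesL) (diamondEdges ++ endEdges q E ++ bridges q E)
           (mapEdge-NotOn _==V_ uL (λ b → uL-==V-endV E b a) edgesL) ⟩
    any p (diamondEdges ++ endEdges q E ++ bridges q E)
      ≡⟨ any-linked-++ˡ _==V_ (endV E a) w diamondEdges (endEdges q E ++ bridges q E)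
           (All-concatMap-allFin _ (λ j → mapEdge-NotOn _==V_ (dm j) (λ b → dm-==V-endV E j b a) edgesD)) ⟩
    any p (endEdges q E ++ bridges q E)
      ≡⟨ any-linked-++ʳ _==V_ (endV E a) w (endEdges q E) (bridges q E)
           (bridges-NotOn (uL-==V-endV E _ a) (λ j → dm-==V-endV E j _ a) (λ j → dm-==V-endV E j _ a) att≠a) ⟩
    any p (endEdges q E)
      ≡⟨ ≡.cong (any p) (endEdges-mapEdge E) ⟩
    any p (mapEdge (endV E) (endEdgeList E)) ∎
    where
    open ≡.≡-Reasoning
    p : Vtx q E × Vtx q E → Bool
    p = linked _==V_ (endV E a) w

neighbours : ∀ {m} → List (Fin m × Fin m) → Fin m → List (Fin m)
neighbours {m} es a = filterᵇ (λ k → any (linked _==F_ a k) es) (allFin m)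

-- Eigenvectors of the second type

module Spectral {c ℓ} (F : Field c ℓ) where
  open Field F
  open FoldMap +-monoid using (foldMap; foldMap-++; foldMap-ε; foldMap-map; foldMap-if; foldMap-concatMap-allFin-single)
  open import Relation.Binary.Reasoning.Setoid setoid

  IsVertexBlock : ∀ {q E m} → (Fin m → Vtx q E) → Set (c ⊔ ℓ)
  IsVertexBlock {q} {E} {m} f =
    ∀ (h : Vtx q E → Carrier) → (∀ w → (∀ k → (f k ==V w) ≡ false) → h w ≈ 0#) →
    foldMap h (vertices q E) ≈ foldMap (h ∘ f) (allFin m)

  module _ {q : ℕ} {E : End} (h : Vtx q E → Carrier) where

    foldMap-vertices : foldMap h (vertices q E) ≈
                       foldMap h (map uL (allFin 5)) + (foldMap h diamondVertices + foldMap h (endVertices q E))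
    foldMap-vertices = trans (foldMap-++ h (map uL (allFin 5)) (diamondVertices ++ endVertices q E))
                             (+-congˡ (foldMap-++ h diamondVertices (endVertices q E)))

    foldMap-uL-ε : (∀ a → h (uL a) ≈ 0#) → foldMap h (map uL (allFin 5)) ≈ 0#
    foldMap-uL-ε h≈0 = foldMap-ε h (All-map-allFin uL h≈0)

    foldMap-diamonds-ε : (∀ j b → h (dm j b) ≈ 0#) → foldMap h diamondVertices ≈ 0#
    foldMap-diamonds-ε h≈0 = foldMap-ε h (All-concatMap-allFin _ (λ j → All-map-allFin (dm j) (h≈0 j)))

    foldMap-end-ε : (∀ k → h (endV E k) ≈ 0#) → foldMap h (endVertices q E) ≈ 0#
    foldMap-end-ε h≈0 = foldMap-ε h (All-endVertices E h≈0)

  module _ {q : ℕ} {E : End} where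

    vertexBlock-uL : IsVertexBlock {q} {E} uL
    vertexBlock-uL h supp = begin
      foldMap h (vertices q E)                  ≈⟨ foldMap-vertices h ⟩
      foldMap (h ∘ uL) (allFin 5) + (_ + _)     ≈⟨ +-congˡ (+-cong diamonds end) ⟩
      foldMap (h ∘ uL) (allFin 5) + (0# + 0#)   ≈⟨ +-congˡ (+-identityˡ 0#) ⟩
      foldMap (h ∘ uL) (allFin 5) + 0#          ≈⟨ +-identityʳ _ ⟩
      foldMap (h ∘ uL) (allFin 5)               ∎
      where
      diamonds : foldMap h diamondVertices ≈ 0#
      diamonds = foldMap-diamonds-ε h (λ j b → supp (dm j b) (λ _ → ≡.refl))
      end : foldMap h (endVertices q E) ≈ 0#
      end = foldMap-end-ε h (λ k → supp (endV E k) (λ a → uL-==V-endV E a k))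

    vertexBlock-dm : ∀ i → IsVertexBlock {q} {E} (dm i)
    vertexBlock-dm i h supp = begin
      foldMap h (vertices q E)                                 ≈⟨ foldMap-vertices h ⟩
      _ + (foldMap h diamondVertices + _)                      ≈⟨ +-cong first (+-cong diamonds end) ⟩
      0# + (foldMap (h ∘ dm i) (allFin 4) + 0#)                ≈⟨ +-identityˡ _ ⟩
      foldMap (h ∘ dm i) (allFin 4) + 0#                       ≈⟨ +-identityʳ _ ⟩
      foldMap (h ∘ dm i) (allFin 4)                            ∎
      where
      first : foldMap h (map uL (allFin 5)) ≈ 0#
      first = foldMap-uL-ε h (λ a → supp (uL a) (λ _ → ≡.refl))
      end : foldMap h (endVertices q E) ≈ 0#
      end = foldMap-end-ε h (λ k → supp (endV E k) (λ b → dm-==V-endV E i b k))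
      diamonds : foldMap h diamondVertices ≈ foldMap (h ∘ dm i) (allFin 4)
      diamonds = foldMap-concatMap-allFin-single h (λ j → map (dm j) (allFin 4)) i
        (λ j j≢i → foldMap-ε h (All-map-allFin (dm j)
          (λ b → supp (dm j b) (λ k → dm-==V-other {E = E} k b (j≢i ∘ ≡.sym)))))

    vertexBlock-end : IsVertexBlock {q} {E} (endV E)
    vertexBlock-end h supp = begin
      foldMap h (vertices q E)                           ≈⟨ foldMap-vertices h ⟩
      _ + (_ + foldMap h (endVertices q E))              ≈⟨ +-cong first (+-cong diamonds (reflexive end)) ⟩
      0# + (0# + foldMap (h ∘ endV E) (allFin _))        ≈⟨ +-identityˡ _ ⟩
      0# + foldMap (h ∘ endV E) (allFin _)               ≈⟨ +-identityˡ _ ⟩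
      foldMap (h ∘ endV E) (allFin _)                    ∎
      where
      first : foldMap h (map uL (allFin 5)) ≈ 0#
      first = foldMap-uL-ε h (λ a → supp (uL a) (λ k → endV-==V-uL E k a))
      diamonds : foldMap h diamondVertices ≈ 0#
      diamonds = foldMap-diamonds-ε h (λ j b → supp (dm j b) (λ k → endV-==V-dm E k j b))
      end : foldMap h (endVertices q E) ≡ foldMap (h ∘ endV E) (allFin (endSize E))
      end = ≡.trans (≡.cong (foldMap h) (endVertices-map E)) (foldMap-map h (endV E) (allFin _))

  adjMul-block : ∀ {q E m} (f : Fin m → Vtx q E) es a (x : Vtx q E → Carrier) →
                 IsVertexBlock f → (∀ b c → (f b ==V f c) ≡ (b ==F c)) →
                 (∀ w → adj (f a) w ≡ any (linked _==V_ (f a) w) (mapEdge f es)) →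
                 adjMul F x (f a) ≈ foldMap (x ∘ f) (neighbours es a)
  adjMul-block {q} {E} {m} f es a x block f-pres adj-local = begin
    adjMul F x (f a)
      ≡⟨ ≡.cong (foldr _+_ 0#) (map-cong (λ w → ≡.cong (if_then x w else 0#) (adj-local w)) (vertices q E)) ⟩
    foldMap h (vertices q E)
      ≈⟨ block h (λ w f≠w → reflexive (≡.cong (if_then x w else 0#)
                    (any-linked-NotOnʳ _==V_ (f a) w (mapEdge-NotOn _==V_ f f≠w es)))) ⟩
    foldMap (h ∘ f) (allFin m)
      ≡⟨ ≡.cong (foldr _+_ 0#) (map-cong (λ k → ≡.cong (if_then x (f k) else 0#)
                    (any-linked-mapEdge _==V_ _==F_ f f-pres a k es)) (allFin m)) ⟩
    foldMap (λ k → if any (linked _==F_ a k) es then x (f k) else 0#) (allFin m)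
      ≈⟨ foldMap-if (x ∘ f) _ (allFin m) ⟩
    foldMap (x ∘ f) (neighbours es a) ∎
    where
    h : Vtx q E → Carrier
    h w = if any (linked _==V_ (f a) w) (mapEdge f es) then x w else 0#

  open import Algebra.Properties.Group +-group using (inverseʳ-unique)
  open import Algebra.Properties.Ring ring using (-1*x≈-x)
  open import Algebra.Solver.Ring.NaturalCoefficients.Default commutativeSemiring using (solve; _:=_; _:+_; _:*_; con)

  *-cancelʳ-≉0 : ∀ {a u v} → a ≉ 0# → u * a ≈ v * a → u ≈ v
  *-cancelʳ-≉0 {a} {u} {v} a≉0 ua≈va with inverse a a≉0
  ... | b , ab≈1 = begin
    u            ≈⟨ *-identityʳ u ⟨
    u * 1#       ≈⟨ *-congˡ ab≈1 ⟨
    u * (a * b)  ≈⟨ *-assoc u a b ⟨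
    u * a * b    ≈⟨ *-congʳ ua≈va ⟩
    v * a * b    ≈⟨ *-assoc v a b ⟩
    v * (a * b)  ≈⟨ *-congˡ ab≈1 ⟩
    v * 1#       ≈⟨ *-identityʳ v ⟩
    v            ∎

  eigenvalue-minus-one : ∀ {l a} → a ≉ 0# → l * a ≈ - a → l ≈ - 1#
  eigenvalue-minus-one {a = a} a≉0 la≈-a = *-cancelʳ-≉0 a≉0 (trans la≈-a (sym (-1*x≈-x a)))

  eigenvalue-zero : ∀ {l a} → a ≉ 0# → l * a ≈ 0# → l ≈ 0#
  eigenvalue-zero {a = a} a≉0 la≈0 = *-cancelʳ-≉0 a≉0 (trans la≈0 (sym (zeroˡ a)))

  quadratic-of-orbit : ∀ {l b c} → l * b ≈ c → l * c + c ≈ b → b ≉ 0# ⊎ c ≉ 0# → l * l + l ≈ 1#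
  quadratic-of-orbit {l} {b} {c} lb≈c lc+c≈b (inj₁ b≉0) = *-cancelʳ-≉0 b≉0 (begin
    (l * l + l) * b      ≈⟨ distribʳ b (l * l) l ⟩
    l * l * b + l * b    ≈⟨ +-congʳ (*-assoc l l b) ⟩
    l * (l * b) + l * b  ≈⟨ +-cong (*-congˡ lb≈c) lb≈c ⟩
    l * c + c            ≈⟨ lc+c≈b ⟩
    b                    ≈⟨ *-identityˡ b ⟨
    1# * b               ∎)
  quadratic-of-orbit {l} {b} {c} lb≈c lc+c≈b (inj₂ c≉0) = *-cancelʳ-≉0 c≉0 (begin
    (l * l + l) * c      ≈⟨ distribʳ c (l * l) l ⟩
    l * l * c + l * c    ≈⟨ +-congʳ (*-assoc l l c) ⟩
    l * (l * c) + l * c  ≈⟨ distribˡ l (l * c) c ⟨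
    l * (l * c + c)      ≈⟨ *-congˡ lc+c≈b ⟩
    l * b                ≈⟨ lb≈c ⟩
    c                    ≈⟨ *-identityˡ c ⟨
    1# * c               ∎)

  -- s = 2l + 1 is a square root of 4(l² + l) + 1 = 5.
  golden-of-quadratic : ∀ {l} → l * l + l ≈ 1# → IsGoldenValue F l
  golden-of-quadratic {l} quad = l + l + 1# , square , linear
    where
    expand : ∀ l → (l + l + 1#) * (l + l + 1#) ≈ (l * l + l) + (l * l + l) + (l * l + l) + (l * l + l) + 1#
    expand = solve 1 (λ l → (l :+ l :+ con 1) :* (l :+ l :+ con 1) :=
                            (l :* l :+ l) :+ (l :* l :+ l) :+ (l :* l :+ l) :+ (l :* l :+ l) :+ con 1) refl
    square : (l + l + 1#) * (l + l + 1#) ≈ 1# + 1# + 1# + 1# + 1#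
    square = trans (expand l) (+-congʳ (+-cong (+-cong (+-cong quad quad) quad) quad))
    linear : l + l ≈ - 1# + (l + l + 1#)
    linear = begin
      l + l                  ≈⟨ +-identityʳ (l + l) ⟨
      l + l + 0#             ≈⟨ +-congˡ (-‿inverseʳ 1#) ⟨
      l + l + (1# + - 1#)    ≈⟨ +-assoc (l + l) 1# (- 1#) ⟨
      l + l + 1# + - 1#      ≈⟨ +-comm _ (- 1#) ⟩
      - 1# + (l + l + 1#)    ∎

  pair-cell : ∀ {a b} → a + (b + 0#) ≈ 0# → b ≈ - a
  pair-cell {a} {b} cell = inverseʳ-unique a b (trans (+-congˡ (sym (+-identityʳ b))) cell)

  pair-cell-≉0 : ∀ {a b} → a + (b + 0#) ≈ 0# → b ≉ 0# → a ≉ 0#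
  pair-cell-≉0 {a} {b} cell b≉0 a≈0 = b≉0 (begin
    b             ≈⟨ +-identityʳ b ⟨
    b + 0#        ≈⟨ +-identityˡ _ ⟨
    0# + (b + 0#) ≈⟨ +-congʳ a≈0 ⟨
    a + (b + 0#)  ≈⟨ cell ⟩
    0#            ∎)

  singleton-cell : ∀ {a} → a + 0# ≈ 0# → a ≈ 0#
  singleton-cell {a} cell = trans (sym (+-identityʳ a)) cell

  pair-cell-cancel : ∀ {a b} c → a + (b + 0#) ≈ 0# → a + (b + c) ≈ c
  pair-cell-cancel {a} {b} c cell = begin
    a + (b + c)          ≈⟨ +-assoc a b c ⟨
    a + b + c            ≈⟨ +-congʳ (+-congˡ (+-identityʳ b)) ⟨
    a + (b + 0#) + c     ≈⟨ +-congʳ cell ⟩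
    0# + c               ≈⟨ +-identityˡ c ⟩
    c                    ∎

  SumsZeroOn : ∀ {m} → (Fin m → Carrier) → List (List (Fin m)) → Set ℓ
  SumsZeroOn y = All (λ C → foldMap y C ≈ 0#)

  L-eigenvalue : ∀ {l} (y : Fin 5 → Carrier) → SumsZeroOn y cellsL →
                 l * y (# 0) ≈ foldMap y (neighbours edgesL (# 0)) →
                 l * y (# 2) ≈ foldMap y (neighbours edgesL (# 2)) →
                 ∀ k → y k ≉ 0# → l ≈ 0# ⊎ l ≈ - 1#
  L-eigenvalue {l} y (c₀₁ ∷ c₂₃ ∷ c₄ ∷ []) row₀ row₂ = nonzero
    where
    minus-one : y (# 0) ≉ 0# → l ≈ - 1#
    minus-one y₀≉0 =
      eigenvalue-minus-one y₀≉0 (trans row₀ (trans (+-cong (pair-cell c₀₁) c₂₃) (+-identityʳ _)))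
    vanishing : y (# 2) ≉ 0# → l ≈ 0#
    vanishing y₂≉0 = eigenvalue-zero y₂≉0 (trans row₂ (trans (+-congˡ (+-congˡ c₄)) c₀₁))
    nonzero : ∀ k → y k ≉ 0# → l ≈ 0# ⊎ l ≈ - 1#
    nonzero fzero                                   = inj₂ ∘ minus-one
    nonzero (fsuc fzero)                            = inj₂ ∘ minus-one ∘ pair-cell-≉0 c₀₁
    nonzero (fsuc (fsuc fzero))                     = inj₁ ∘ vanishing
    nonzero (fsuc (fsuc (fsuc fzero)))              = inj₁ ∘ vanishing ∘ pair-cell-≉0 c₂₃
    nonzero (fsuc (fsuc (fsuc (fsuc fzero)))) y₄≉0  = contradiction (singleton-cell c₄) y₄≉0

  diamond-eigenvalue : ∀ {l} (y : Fin 4 → Carrier) → SumsZeroOn y cellsD →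
                       l * y (# 1) ≈ foldMap y (neighbours edgesD (# 1)) →
                       ∀ k → y k ≉ 0# → l ≈ - 1#
  diamond-eigenvalue {l} y (c₀ ∷ c₁₂ ∷ c₃ ∷ []) row₁ = nonzero
    where
    minus-one : y (# 1) ≉ 0# → l ≈ - 1#
    minus-one y₁≉0 = eigenvalue-minus-one y₁≉0 (begin
      l * y (# 1)                           ≈⟨ row₁ ⟩
      y (# 0) + (y (# 2) + (y (# 3) + 0#))  ≈⟨ +-cong (singleton-cell c₀) (+-congˡ c₃) ⟩
      0# + (y (# 2) + 0#)                   ≈⟨ +-identityˡ _ ⟩
      y (# 2) + 0#                          ≈⟨ +-identityʳ _ ⟩
      y (# 2)                               ≈⟨ pair-cell c₁₂ ⟩
      - y (# 1)                             ∎)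
    nonzero : ∀ k → y k ≉ 0# → l ≈ - 1#
    nonzero fzero                       y₀≉0 = contradiction (singleton-cell c₀) y₀≉0
    nonzero (fsuc fzero)                     = minus-one
    nonzero (fsuc (fsuc fzero))              = minus-one ∘ pair-cell-≉0 c₁₂
    nonzero (fsuc (fsuc (fsuc fzero)))  y₃≉0 = contradiction (singleton-cell c₃) y₃≉0

  L'-eigenvalue : ∀ {l} (y : Fin 7 → Carrier) → SumsZeroOn y cellsL' →
                  l * y (# 0) ≈ foldMap y (neighbours edgesL' (# 0)) →
                  l * y (# 2) ≈ foldMap y (neighbours edgesL' (# 2)) →
                  l * y (# 4) ≈ foldMap y (neighbours edgesL' (# 4)) →
                  ∀ k → y k ≉ 0# → l ≈ - 1# ⊎ IsGoldenValue F l
  L'-eigenvalue {l} y (c₀₁ ∷ c₂₃ ∷ c₄₅ ∷ c₆ ∷ []) row₀ row₂ row₄ = nonzero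
    where
    minus-one : y (# 0) ≉ 0# → l ≈ - 1#
    minus-one y₀≉0 =
      eigenvalue-minus-one y₀≉0 (trans row₀ (trans (+-cong (pair-cell c₀₁) c₂₃) (+-identityʳ _)))
    orbit₂ : l * y (# 2) ≈ y (# 4)
    orbit₂ = trans row₂ (trans (pair-cell-cancel _ c₀₁) (+-identityʳ _))
    orbit₄ : l * y (# 4) + y (# 4) ≈ y (# 2)
    orbit₄ = begin
      l * y (# 4) + y (# 4)                  ≈⟨ +-congʳ (trans row₄ (+-congˡ (+-congˡ c₆))) ⟩
      y (# 2) + (y (# 5) + 0#) + y (# 4)     ≈⟨ +-assoc _ _ _ ⟩
      y (# 2) + (y (# 5) + 0# + y (# 4))     ≈⟨ +-congˡ (+-comm _ (y (# 4))) ⟩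
      y (# 2) + (y (# 4) + (y (# 5) + 0#))   ≈⟨ +-congˡ c₄₅ ⟩
      y (# 2) + 0#                           ≈⟨ +-identityʳ _ ⟩
      y (# 2)                                ∎
    golden : y (# 2) ≉ 0# ⊎ y (# 4) ≉ 0# → IsGoldenValue F l
    golden = golden-of-quadratic ∘ quadratic-of-orbit orbit₂ orbit₄
    nonzero : ∀ k → y k ≉ 0# → l ≈ - 1# ⊎ IsGoldenValue F l
    nonzero fzero                                           = inj₁ ∘ minus-one
    nonzero (fsuc fzero)                                    = inj₁ ∘ minus-one ∘ pair-cell-≉0 c₀₁
    nonzero (fsuc (fsuc fzero))                             = inj₂ ∘ golden ∘ inj₁
    nonzero (fsuc (fsuc (fsuc fzero)))                      = inj₂ ∘ golden ∘ inj₁ ∘ pair-cell-≉0 c₂₃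
    nonzero (fsuc (fsuc (fsuc (fsuc fzero))))               = inj₂ ∘ golden ∘ inj₂
    nonzero (fsuc (fsuc (fsuc (fsuc (fsuc fzero)))))        = inj₂ ∘ golden ∘ inj₂ ∘ pair-cell-≉0 c₄₅
    nonzero (fsuc (fsuc (fsuc (fsuc (fsuc (fsuc fzero)))))) y₆≉0 = contradiction (singleton-cell c₆) y₆≉0

  module _ {q : ℕ} {E : End} {x : Vtx q E → Carrier} where

    cellSums-uL : SecondType F q E x → SumsZeroOn (x ∘ uL) cellsL
    cellSums-uL (c₀₁ ∷ c₂₃ ∷ c₄ ∷ _) = c₀₁ ∷ c₂₃ ∷ c₄ ∷ []

    cellSums-dm : SecondType F q E x → ∀ i → SumsZeroOn (x ∘ dm i) cellsD
    cellSums-dm second i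
      with All-concatMap-allFin⁻ _ (AllP.++⁻ˡ diamondCells (AllP.++⁻ʳ (map (map uL) cellsL) second)) i
    ... | c₀ ∷ c₁₂ ∷ c₃ ∷ [] = c₀ ∷ c₁₂ ∷ c₃ ∷ []

    cellSums-end : SecondType F q E x → All (λ C → foldMap x C ≈ 0#) (endCells q E)
    cellSums-end second = AllP.++⁻ʳ diamondCells (AllP.++⁻ʳ (map (map uL) cellsL) second)

  cellSums-eL : ∀ {q} {x : Vtx q endL → Carrier} → SecondType F q endL x → SumsZeroOn (x ∘ eL) cellsL
  cellSums-eL second with cellSums-end second
  ... | c₀₁ ∷ c₂₃ ∷ c₄ ∷ [] = c₀₁ ∷ c₂₃ ∷ c₄ ∷ []

  cellSums-eL' : ∀ {q} {x : Vtx q endL' → Carrier} → SecondType F q endL' x → SumsZeroOn (x ∘ eL') cellsL'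
  cellSums-eL' second with cellSums-end second
  ... | c₀₁ ∷ c₂₃ ∷ c₄₅ ∷ c₆ ∷ [] = c₀₁ ∷ c₂₃ ∷ c₄₅ ∷ c₆ ∷ []

  module _ {q : ℕ} {E : End} {l : Carrier} {x : Vtx q E → Carrier}
           (eigen : ∀ v → adjMul F x v ≈ l * x v) where

    row-uL : ∀ a → (uL {q} {E} (# 4) ==V uL a) ≡ false →
             l * x (uL a) ≈ foldMap (x ∘ uL) (neighbours edgesL a)
    row-uL a a≠u₅ = trans (sym (eigen (uL a)))
      (adjMul-block uL edgesL a x vertexBlock-uL (λ _ _ → ≡.refl) (adj-uL a a≠u₅))

    row-dm : ∀ i → l * x (dm i (# 1)) ≈ foldMap (x ∘ dm i) (neighbours edgesD (# 1))
    row-dm i = trans (sym (eigen (dm i (# 1))))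
      (adjMul-block (dm i) edgesD (# 1) x (vertexBlock-dm i) (dm-==V-same {E = E} i) (adj-dm i))

    row-end : ∀ a → (endV E (attachIndex E) ==V endV E a) ≡ false →
              l * x (endV E a) ≈ foldMap (x ∘ endV E) (neighbours (endEdgeList E) a)
    row-end a a≠att = trans (sym (eigen (endV E a)))
      (adjMul-block (endV E) (endEdgeList E) a x vertexBlock-end (endV-==V-endV E) (adj-end a a≠att))

  module _ {q : ℕ} {E : End} {l : Carrier} {x : Vtx q E → Carrier}
           (eigen : ∀ v → adjMul F x v ≈ l * x v) (second : SecondType F q E x) where

    nonzero-on-uL : ∀ k → x (uL k) ≉ 0# → l ≈ 0# ⊎ l ≈ - 1#
    nonzero-on-uL =
      L-eigenvalue (x ∘ uL) (cellSums-uL second) (row-uL eigen (# 0) ≡.refl) (row-uL eigen (# 2) ≡.refl)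

    nonzero-on-dm : ∀ i k → x (dm i k) ≉ 0# → l ≈ - 1#
    nonzero-on-dm i = diamond-eigenvalue (x ∘ dm i) (cellSums-dm second i) (row-dm eigen i)

  module _ {q : ℕ} {l : Carrier} where

    nonzero-on-eL : ∀ {x : Vtx q endL → Carrier} →
                    (∀ v → adjMul F x v ≈ l * x v) → SecondType F q endL x →
                    ∀ k → x (eL k) ≉ 0# → l ≈ 0# ⊎ l ≈ - 1#
    nonzero-on-eL {x} eigen second =
      L-eigenvalue (x ∘ eL) (cellSums-eL second) (row-end eigen (# 0) ≡.refl) (row-end eigen (# 2) ≡.refl)

    nonzero-on-eL' : ∀ {x : Vtx q endL' → Carrier} →
                     (∀ v → adjMul F x v ≈ l * x v) → SecondType F q endL' x →
                     ∀ k → x (eL' k) ≉ 0# → l ≈ - 1# ⊎ IsGoldenValue F l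
    nonzero-on-eL' {x} eigen second =
      L'-eigenvalue (x ∘ eL') (cellSums-eL' second)
                    (row-end eigen (# 0) ≡.refl) (row-end eigen (# 2) ≡.refl) (row-end eigen (# 4) ≡.refl)

  from-zero-or-minus-one : ∀ {A B : Set} {l} → l ≈ 0# ⊎ l ≈ - 1# →
                           (A → l ≈ 0# ⊎ l ≈ - 1#) × (B → l ≈ 0# ⊎ l ≈ - 1# ⊎ IsGoldenValue F l)
  from-zero-or-minus-one l∈ = (λ _ → l∈) , (λ _ → Sum.map₂ inj₁ l∈)

module _ where
  open import Data.Nat using (_+_; _*_)
  open import Data.Nat.Properties using (+-comm)

  length-concat-tabulate : ∀ {A : Set} {n k} (G : Fin n → List A) → (∀ i → length (G i) ≡ k) →
                           length (concat (tabulate G)) ≡ n * k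
  length-concat-tabulate {n = ℕ.zero}  G len = ≡.refl
  length-concat-tabulate {n = ℕ.suc n} G len =
    ≡.trans (length-++ (G fzero)) (≡.cong₂ _+_ (len fzero) (length-concat-tabulate (G ∘ fsuc) (len ∘ fsuc)))

  order-endL'-mod4 : ∀ q → order q endL' % 4 ≡ 0
  order-endL'-mod4 q = ≡.trans (≡.cong (_% 4) order≡) ([m+kn]%n≡m%n 12 q 4)
    where
    diamonds≡ : length (diamondVertices {q} {endL'}) ≡ q * 4
    diamonds≡ = ≡.trans (≡.cong (length ∘ concat) (map-tabulate {n = q} (λ j → j) block))
                        (length-concat-tabulate block (λ _ → ≡.refl))
      where
      block : Fin q → List (Vtx q endL')
      block j = map (dm j) (allFin 4)
    order≡ : order q endL' ≡ 12 + q * 4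
    order≡ = ≡.cong (5 +_) (≡.trans (length-++ (diamondVertices {q} {endL'}))
                                    (≡.trans (≡.cong (_+ 7) diamonds≡) (+-comm (q * 4) 7)))

open Spectral using (nonzero-on-uL; nonzero-on-dm; nonzero-on-eL; nonzero-on-eL'; from-zero-or-minus-one)

mainTheorem1 : ∀ {c ℓ} (F : Field c ℓ) (q : ℕ) (E : End) (λ' : Field.Carrier F)
                 (x : Vtx q E → Field.Carrier F) →
                 IsEigenvector F q E λ' x → SecondType F q E x →
                 ((order q E % 4 ≡ 2) →
                    (Field._≈_ F λ' (Field.0# F) ⊎ Field._≈_ F λ' (Field.-_ F (Field.1# F))))
                 × ((order q E % 4 ≡ 0) →
                    (Field._≈_ F λ' (Field.0# F) ⊎ Field._≈_ F λ' (Field.-_ F (Field.1# F))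
                      ⊎ IsGoldenValue F λ'))
mainTheorem1 F q E λ' x ((uL k , x≉0) , eigen) second =
  from-zero-or-minus-one F (nonzero-on-uL F eigen second k x≉0)
mainTheorem1 F q E λ' x ((dm i k , x≉0) , eigen) second =
  from-zero-or-minus-one F (inj₂ (nonzero-on-dm F eigen second i k x≉0))
mainTheorem1 F q .endL λ' x ((eL k , x≉0) , eigen) second =
  from-zero-or-minus-one F (nonzero-on-eL F eigen second k x≉0)
mainTheorem1 F q .endL' λ' x ((eL' k , x≉0) , eigen) second =
  (λ order≡2 → contradiction (≡.trans (≡.sym (order-endL'-mod4 q)) order≡2) λ ()) ,
  (λ _ → inj₂ (nonzero-on-eL' F eigen second k x≉0))
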